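{- Let $m\ge2$ be an integer and $y>0$, $z>0$ real. Let $\tau(m,y,z)$ be the number of distinct positive integers $n\le z$ that can be written as $n=dl$ with $d$ a positive divisor of $m$ and $l$ a $y$-smooth positive integer. Then $\tau(m,y,z)\le\Psi(z,q)$, where $q$ is the largest prime number with $$\prod_{\substack{y<\ell\le q\\ \ell\ \mathrm{prime}}}\ell\le m.$$
   Context: A positive integer is $y$-smooth if all its prime factors are at most $y$. $\Psi(x,y)$ is the number of $y$-smooth positive integers $n\le x$. -}

module Defs where

open import Data.Nat using (ℕ; zero; suc; _+_; _*_; _∸_; _≤_; _<_; z≤n; s≤s; _≤?_)
open import Data.Nat.Properties using (*-comm; ≤-refl)
open import Data.Nat.Divisibility using (_∣_; _∣?_; ∣⇒≤; divides)
open import Data.Nat.Primality using (Prime; prime?)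
open import Data.Fin using (Fin; toℕ; fromℕ<)
open import Data.Fin.Properties using (any?; all?; toℕ<n; toℕ-fromℕ<)
open import Data.List using (List; length; filter; map; upTo)
open import Data.Nat.ListAction using (product)
open import Data.Product using (Σ; ∃; _×_; _,_)
open import Relation.Nullary using (Dec; yes; no)
open import Relation.Nullary.Decidable using (_→-dec_; _×-dec_; map′)
open import Relation.Binary.PropositionalEquality using (_≡_; refl; subst; sym; trans; cong₂)
open import Data.Nat using (_≟_)

Smooth : ℕ → ℕ → Set
Smooth y n = ∀ p → Prime p → p ∣ n → p ≤ y

private
  BSmooth : ℕ → ℕ → Set
  BSmooth y k = ∀ (i : Fin (suc (suc k))) → Prime (toℕ i) → toℕ i ∣ suc k → toℕ i ≤ y

  b⇒s : ∀ y k → BSmooth y k → Smooth y (suc k)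
  b⇒s y k b p pp p∣ =
    let i = fromℕ< {p} {suc (suc k)} (s≤s (∣⇒≤ p∣)) in
    subst (_≤ y) (toℕ-fromℕ< (s≤s (∣⇒≤ p∣)))
      (b i (subst Prime (sym (toℕ-fromℕ< (s≤s (∣⇒≤ p∣)))) pp)
           (subst (_∣ suc k) (sym (toℕ-fromℕ< (s≤s (∣⇒≤ p∣)))) p∣))

smooth? : ∀ y k → Dec (Smooth y (suc k))
smooth? y k = map′ (b⇒s y k) (λ s i → s (toℕ i))
  (all? (λ i → prime? (toℕ i) →-dec ((toℕ i ∣? suc k) →-dec (toℕ i ≤? y))))

PosSmooth : ℕ → ℕ → Set
PosSmooth y l = 1 ≤ l × Smooth y l

posSmooth? : ∀ y l → Dec (PosSmooth y l)
posSmooth? y zero = no (λ { (() , _) })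
posSmooth? y (suc k) with smooth? y k
... | yes s = yes (s≤s z≤n , s)
... | no ¬s = no (λ { (_ , s) → ¬s s })

-- Ψ(x,y): number of y-smooth positive integers n ≤ x  (n = suc k, k < x)
Ψ : ℕ → ℕ → ℕ
Ψ x y = length (filter (λ k → smooth? y k) (upTo x))

Rep : ℕ → ℕ → ℕ → Set
Rep m y n = Σ ℕ λ d → Σ ℕ λ l → (1 ≤ d × d ∣ m) × PosSmooth y l × n ≡ d * l

private
  BRep : ℕ → ℕ → ℕ → Set
  BRep m y k = Σ (Fin (suc (suc k))) λ i → Σ (Fin (suc (suc k))) λ j →
    ((1 ≤ toℕ i × toℕ i ∣ m) × PosSmooth y (toℕ j)) × suc k ≡ toℕ i * toℕ j

  b⇒r : ∀ m y k → BRep m y k → Rep m y (suc k)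
  b⇒r m y k (i , j , (a , b) , e) = toℕ i , toℕ j , a , b , e

  r⇒b : ∀ m y k → Rep m y (suc k) → BRep m y k
  r⇒b m y k (d , l , a , b , e) =
    let d≤ : d ≤ suc k
        d≤ = ∣⇒≤ (divides l (trans e (*-comm d l)))
        l≤ : l ≤ suc k
        l≤ = ∣⇒≤ (divides d e)
        ei = toℕ-fromℕ< (s≤s d≤)
        ej = toℕ-fromℕ< (s≤s l≤)
    in fromℕ< (s≤s d≤) , fromℕ< (s≤s l≤) ,
       (subst (λ t → 1 ≤ t × t ∣ m) (sym ei) a , subst (PosSmooth y) (sym ej) b) ,
       subst (λ t → suc k ≡ t) (sym (cong₂ _*_ ei ej)) e

rep? : ∀ m y k → Dec (Rep m y (suc k))
rep? m y k = map′ (b⇒r m y k) (r⇒b m y k)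
  (any? (λ i → any? (λ j →
     (((1 ≤? toℕ i) ×-dec (toℕ i ∣? m)) ×-dec posSmooth? y (toℕ j))
     ×-dec (suc k ≟ toℕ i * toℕ j))))

τ : ℕ → ℕ → ℕ → ℕ
τ m y z = length (filter (λ k → rep? m y k) (upTo z))

-- product of the primes ℓ with y < ℓ ≤ q
primeProd : ℕ → ℕ → ℕ
primeProd y q = product (filter prime? (map (λ i → y + suc i) (upTo (q ∸ y))))

{-# OPTIONS --safe #-}
module Submission where

-- Strong induction on m. If every prime factor of m is at most q, each n = d l counted by τ is
-- q-smooth, since a prime r ≤ y has primeProd y r = 1 ≤ m and hence r ≤ q. Otherwise some prime
-- ℓ > q divides m, so primeProd y ℓ > m and some prime p with y < p < ℓ does not divide m.
-- Writing m = ℓ^a m₀ with ℓ ∤ m₀, the map ℓ^b u ↦ p^b u (ℓ ∤ u) sends the numbers counted by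
-- τ m y z injectively, and without increasing them, to numbers counted by τ (p^a m₀) y z,
-- and p^a m₀ < m.

open import Defs
open import Data.Nat
open import Data.Nat.Properties
open import Data.Nat.Induction using (<-rec)
open import Data.Nat.Divisibility
open import Data.Nat.Primality
open import Data.Nat.Coprimality using (Coprime; coprime-divisor)
open import Data.Nat.ListAction using (product)
open import Data.List using ([]; _∷_; length; filter; map; upTo)
open import Data.List.Membership.Propositional using (_∈_)
open import Data.List.Membership.Propositional.Properties
  using (∈-filter⁺; ∈-filter⁻; ∈-upTo⁺; ∈-upTo⁻; ∈-map⁻)
open import Data.List.Relation.Unary.Any using (here; there)
open import Data.List.Relation.Unary.All as All using (All; []; _∷_)
open import Data.List.Relation.Unary.AllPairs using ([]; _∷_)
open import Data.List.Relation.Unary.Unique.Propositional using (Unique)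
import Data.List.Relation.Unary.Unique.Propositional.Properties as Unique
open import Data.Product using (∃; _×_; _,_; proj₁; proj₂)
open import Data.Sum using (inj₁; inj₂)
open import Function using (_∘_; id)
open import Relation.Nullary using (¬_; Dec; yes; no; contradiction)
open import Relation.Nullary.Decidable using (_×-dec_; ¬?)
open import Relation.Unary using (Pred; Decidable)
open import Relation.Binary.PropositionalEquality
open ≡-Reasoning

module _ {a b} {A : Set a} {B : Set b} where

  private
    ∈-remove : ∀ {x : B} {ys} → x ∈ ys →
               ∃ λ zs → length ys ≡ suc (length zs) × (∀ {w} → w ∈ ys → w ≢ x → w ∈ zs)
    ∈-remove {ys = _ ∷ ys} (here refl) =
      ys , refl , λ { (here refl) w≢x → contradiction refl w≢x ; (there w∈) _ → w∈ }
    ∈-remove {ys = y ∷ _} (there x∈) with ∈-remove x∈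
    ... | zs , len≡ , keep =
      y ∷ zs , cong suc len≡ , λ { (here refl) _ → here refl ; (there w∈) w≢x → there (keep w∈ w≢x) }

  length-≤-injection : ∀ (f : A → B) {xs ys} → Unique xs → (∀ {x} → x ∈ xs → f x ∈ ys) →
                       (∀ {x x′} → x ∈ xs → x′ ∈ xs → f x ≡ f x′ → x ≡ x′) →
                       length xs ≤ length ys
  length-≤-injection f {[]} _ _ _ = z≤n
  length-≤-injection f {x ∷ xs} (x∉xs ∷ uniq) maps inj with ∈-remove (maps (here refl))
  ... | zs , len≡ , keep = subst (suc (length xs) ≤_) (sym len≡)
          (s≤s (length-≤-injection f uniq maps′ (λ x∈ x′∈ → inj (there x∈) (there x′∈))))
    where
    maps′ : ∀ {w} → w ∈ xs → f w ∈ zs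
    maps′ w∈ = keep (maps (there w∈))
      (λ fw≡fx → All.lookup x∉xs w∈ (sym (inj (there w∈) (here refl) fw≡fx)))

-- τ and Ψ are instances, with P k a property of n = k + 1.
count : ∀ {p} {P : Pred ℕ p} → Decidable P → ℕ → ℕ
count P? z = length (filter P? (upTo z))

count-≤-injection : ∀ {p q} {P : Pred ℕ p} {Q : Pred ℕ q} (P? : Decidable P) (Q? : Decidable Q)
                    (f : ℕ → ℕ) → (∀ {k} → P k → Q (f k)) → (∀ {k} → P k → f k ≤ k) →
                    (∀ {j k} → P j → P k → f j ≡ f k → j ≡ k) →
                    ∀ z → count P? z ≤ count Q? z
count-≤-injection {P = P} P? Q? f maps shrinks inj z =
  length-≤-injection f (Unique.filter⁺ P? (Unique.upTo⁺ z)) maps′ (λ j∈ k∈ → inj (holds j∈) (holds k∈))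
  where
  holds : ∀ {k} → k ∈ filter P? (upTo z) → P k
  holds = proj₂ ∘ ∈-filter⁻ P? {xs = upTo z}

  maps′ : ∀ {k} → k ∈ filter P? (upTo z) → f k ∈ filter Q? (upTo z)
  maps′ k∈ with ∈-filter⁻ P? {xs = upTo z} k∈
  ... | k<z , Pk = ∈-filter⁺ Q? {xs = upTo z} (∈-upTo⁺ (≤-<-trans (shrinks Pk) (∈-upTo⁻ k<z))) (maps Pk)

record PrimePowerSplit (ℓ n : ℕ) : Set where
  constructor mkSplit
  field
    exponent cofactor : ℕ
    split     : n ≡ ℓ ^ exponent * cofactor
    ∤cofactor : ¬ ℓ ∣ cofactor

∤⇒nonZero : ∀ {d n} → ¬ d ∣ n → NonZero n
∤⇒nonZero {d} {n} d∤n = ≢-nonZero λ { refl → d∤n (d ∣0) }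

splitPrimePower : ∀ {ℓ} → Prime ℓ → ∀ n .{{_ : NonZero n}} → PrimePowerSplit ℓ n
splitPrimePower {ℓ} pℓ = <-rec (λ n → .{{NonZero n}} → PrimePowerSplit ℓ n) go
  where
  instance
    ℓ-nonTrivial : NonTrivial ℓ
    ℓ-nonTrivial = prime⇒nonTrivial pℓ

  go : ∀ n → (∀ {m} → m < n → .{{NonZero m}} → PrimePowerSplit ℓ m) →
       .{{NonZero n}} → PrimePowerSplit ℓ n
  go n rec with ℓ ∣? n
  ... | no ℓ∤n = mkSplit 0 n (sym (*-identityˡ n)) ℓ∤n
  ... | yes ℓ∣n with rec (quotient-< ℓ∣n) {{quotient≢0 ℓ∣n}}
  ...   | mkSplit b u quotient≡ ℓ∤u = mkSplit (suc b) u n≡ ℓ∤u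
    where
    n≡ : n ≡ ℓ * ℓ ^ b * u
    n≡ = begin
      n                 ≡⟨ m∣n⇒n≡quotient*m ℓ∣n ⟩
      quotient ℓ∣n * ℓ  ≡⟨ cong (_* ℓ) quotient≡ ⟩
      ℓ ^ b * u * ℓ     ≡⟨ *-comm (ℓ ^ b * u) ℓ ⟩
      ℓ * (ℓ ^ b * u)   ≡⟨ *-assoc ℓ (ℓ ^ b) u ⟨
      ℓ * ℓ ^ b * u     ∎

prime∤⇒coprime : ∀ {ℓ u} → Prime ℓ → ¬ ℓ ∣ u → Coprime u ℓ
prime∤⇒coprime pℓ ℓ∤u (d∣u , d∣ℓ) with prime⇒irreducible pℓ d∣ℓ
... | inj₁ d≡1 = d≡1
... | inj₂ refl = contradiction d∣u ℓ∤u

coprime-^-divisor : ∀ {u ℓ v} → Coprime u ℓ → ∀ a → u ∣ ℓ ^ a * v → u ∣ v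
coprime-^-divisor {v = v} _ zero u∣ = subst (_ ∣_) (*-identityˡ v) u∣
coprime-^-divisor {u} {ℓ} {v} u⊥ℓ (suc a) u∣ =
  coprime-^-divisor u⊥ℓ a (coprime-divisor u⊥ℓ (subst (u ∣_) (*-assoc ℓ (ℓ ^ a) v) u∣))

prime-split-∣ : ∀ {ℓ u v} → Prime ℓ → ¬ ℓ ∣ u → ¬ ℓ ∣ v →
                ∀ b a → ℓ ^ b * u ∣ ℓ ^ a * v → b ≤ a × u ∣ v
prime-split-∣ {u = u} pℓ ℓ∤u _ zero a ∣ =
  z≤n , coprime-^-divisor (prime∤⇒coprime pℓ ℓ∤u) a (subst (_∣ _) (*-identityˡ u) ∣)
prime-split-∣ {ℓ} {u} {v} _ _ ℓ∤v (suc b) zero ∣ =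
  contradiction (∣-trans (∣m⇒∣m*n u (m∣m*n (ℓ ^ b))) (subst (_ ∣_) (*-identityˡ v) ∣)) ℓ∤v
prime-split-∣ {ℓ} {u} {v} pℓ ℓ∤u ℓ∤v (suc b) (suc a) ∣
  with prime-split-∣ pℓ ℓ∤u ℓ∤v b a
         (*-cancelˡ-∣ ℓ {{prime⇒nonZero pℓ}} (subst₂ _∣_ (*-assoc ℓ (ℓ ^ b) u) (*-assoc ℓ (ℓ ^ a) v) ∣))
... | b≤a , u∣v = s≤s b≤a , u∣v

prime-split-injective : ∀ {ℓ u v} → Prime ℓ → ¬ ℓ ∣ u → ¬ ℓ ∣ v →
                        ∀ b c → ℓ ^ b * u ≡ ℓ ^ c * v → b ≡ c × u ≡ v
prime-split-injective pℓ ℓ∤u ℓ∤v b c eq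
  with prime-split-∣ pℓ ℓ∤u ℓ∤v b c (∣-reflexive eq) | prime-split-∣ pℓ ℓ∤v ℓ∤u c b (∣-reflexive (sym eq))
... | b≤c , u∣v | c≤b , v∣u = ≤-antisym b≤c c≤b , ∣-antisym u∣v v∣u

prime∤product : ∀ {p es} → Prime p → All Prime es → All (p ≢_) es → ¬ p ∣ product es
prime∤product pp [] [] p∣1 = ¬prime[1] (subst Prime (∣1⇒≡1 p∣1) pp)
prime∤product {es = e ∷ es} pp (pe ∷ primes) (p≢e ∷ p∉es) p∣ with euclidsLemma e (product es) pp p∣
... | inj₁ p∣e with prime⇒irreducible pe p∣e
...   | inj₁ refl = ¬prime[1] pp
...   | inj₂ p≡e = p≢e p≡e
prime∤product pp (_ ∷ primes) (_ ∷ p∉es) _ | inj₂ p∣es = prime∤product pp primes p∉es p∣es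

product-primes-∣ : ∀ {es m} → Unique es → All Prime es → All (_∣ m) es → product es ∣ m
product-primes-∣ [] [] [] = 1∣ _
product-primes-∣ {e ∷ es} {m} (e∉es ∷ uniq) (pe ∷ primes) (e∣m ∷ divs)
  with product-primes-∣ uniq primes divs
... | divides c m≡ with euclidsLemma c (product es) pe (subst (e ∣_) m≡ e∣m)
...   | inj₂ e∣es = contradiction e∣es (prime∤product pe primes e∉es)
...   | inj₁ (divides c′ refl) = divides c′ (trans m≡ (*-assoc c′ e (product es)))

primeProd-≡1 : ∀ {y r} → r ≤ y → primeProd y r ≡ 1
primeProd-≡1 r≤y rewrite m≤n⇒m∸n≡0 r≤y = refl

primeProd-∣ : ∀ {y ℓ m} → (∀ {e} → Prime e → y < e → e ≤ ℓ → e ∣ m) → primeProd y ℓ ∣ m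
primeProd-∣ {y} {ℓ} divs =
  product-primes-∣ (Unique.filter⁺ prime? (Unique.map⁺ shift-injective (Unique.upTo⁺ (ℓ ∸ y))))
    (All.tabulate (proj₁ ∘ member))
    (All.tabulate λ e∈ → let pe , y<e , e≤ℓ = member e∈ in divs pe y<e e≤ℓ)
  where
  shift : ℕ → ℕ
  shift i = y + suc i

  shift-injective : ∀ {i j} → shift i ≡ shift j → i ≡ j
  shift-injective {i} {j} = suc-injective ∘ +-cancelˡ-≡ y (suc i) (suc j)

  shift-≤ : ∀ {i} → i < ℓ ∸ y → shift i ≤ ℓ
  shift-≤ {i} i< = subst (_≤ ℓ) (+-comm (suc i) y)
    (m≤o∸n⇒m+n≤o (suc i) (<⇒≤ (m∸n≢0⇒n<m (n>0⇒n≢0 (≤-<-trans z≤n i<)))) i<)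

  member : ∀ {e} → e ∈ filter prime? (map shift (upTo (ℓ ∸ y))) → Prime e × y < e × e ≤ ℓ
  member e∈ with ∈-filter⁻ prime? {xs = map shift (upTo (ℓ ∸ y))} e∈
  ... | e∈map , pe with ∈-map⁻ shift e∈map
  ...   | i , i∈ , refl = pe , m<m+n y z<s , shift-≤ (∈-upTo⁻ i∈)

PrimeProdBound : ℕ → ℕ → ℕ → Set
PrimeProdBound y m q = ∀ p → Prime p → primeProd y p ≤ m → p ≤ q

PrimeProdBound-anti : ∀ {y m m′ q} → m′ ≤ m → PrimeProdBound y m q → PrimeProdBound y m′ q
PrimeProdBound-anti m′≤m bound p pp ≤m′ = bound p pp (≤-trans ≤m′ m′≤m)

τ≤Ψ-if-prime-factors-≤ : ∀ {m y q} .{{_ : NonZero m}} → PrimeProdBound y m q →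
                          (∀ r → Prime r → r ∣ m → r ≤ q) → ∀ z → τ m y z ≤ Ψ z q
τ≤Ψ-if-prime-factors-≤ {m} {y} {q} bound factors =
  count-≤-injection (rep? m y) (smooth? q) id rep⇒smooth (λ _ → ≤-refl) (λ _ _ → id)
  where
  rep⇒smooth : ∀ {k} → Rep m y (suc k) → Smooth q (suc k)
  rep⇒smooth (d , l , (_ , d∣m) , (_ , l-smooth) , n≡dl) r pr r∣n
    with euclidsLemma d l pr (subst (r ∣_) n≡dl r∣n)
  ... | inj₁ r∣d = factors r pr (∣-trans r∣d d∣m)
  ... | inj₂ r∣l = bound r pr (subst (_≤ m) (sym (primeProd-≡1 (l-smooth r pr r∣l))) (>-nonZero⁻¹ m))

∃-prime-nondivisor-below : ∀ {y ℓ m} .{{_ : NonZero m}} → ℓ ∣ m → m < primeProd y ℓ →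
                           ∃ λ p → p < ℓ × Prime p × y < p × ¬ p ∣ m
∃-prime-nondivisor-below {y} {ℓ} {m} ℓ∣m m<prod
  with anyUpTo? (λ p → prime? p ×-dec y <? p ×-dec ¬? (p ∣? m)) ℓ
... | yes found = found
... | no none = contradiction (∣⇒≤ (primeProd-∣ all-divide)) (<⇒≱ m<prod)
  where
  all-divide : ∀ {e} → Prime e → y < e → e ≤ ℓ → e ∣ m
  all-divide {e} pe y<e e≤ℓ with e ≟ ℓ | e ∣? m
  ... | yes refl | _        = ℓ∣m
  ... | no _     | yes e∣m  = e∣m
  ... | no e≢ℓ   | no e∤m   = contradiction (e , ≤∧≢⇒< e≤ℓ e≢ℓ , pe , y<e , e∤m) none

^-monoʳ-∣ : ∀ p {f a} → f ≤ a → p ^ f ∣ p ^ a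
^-monoʳ-∣ p {a = a} z≤n = 1∣ (p ^ a)
^-monoʳ-∣ p (s≤s f≤a)   = *-monoʳ-∣ p (^-monoʳ-∣ p f≤a)

module _ {m y ℓ p a m₀ : ℕ} (pℓ : Prime ℓ) (pp : Prime p) (y<p : y < p) (p≤ℓ : p ≤ ℓ)
         (p∤m : ¬ p ∣ m) (m≡ : m ≡ ℓ ^ a * m₀) (ℓ∤m₀ : ¬ ℓ ∣ m₀) where

  private
    open PrimePowerSplit

    instance
      p-nonZero : NonZero p
      p-nonZero = prime⇒nonZero pp

    swapped : ∀ {n} → PrimePowerSplit ℓ n → ℕ
    swapped s = p ^ exponent s * cofactor s

    swapped-nonZero : ∀ {n} (s : PrimePowerSplit ℓ n) → NonZero (swapped s)
    swapped-nonZero s = m*n≢0 (p ^ exponent s) (cofactor s) {{m^n≢0 p (exponent s)}} {{∤⇒nonZero (∤cofactor s)}}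

    swapped-≤ : ∀ {n} (s : PrimePowerSplit ℓ n) → swapped s ≤ n
    swapped-≤ s = subst (swapped s ≤_) (sym (split s)) (*-monoˡ-≤ (cofactor s) (^-monoˡ-≤ (exponent s) p≤ℓ))

    p∤cofactor : ∀ {n} (s : PrimePowerSplit ℓ n) → ¬ p ∣ n → ¬ p ∣ cofactor s
    p∤cofactor s p∤n p∣u = p∤n (subst (p ∣_) (sym (split s)) (∣n⇒∣m*n (ℓ ^ exponent s) p∣u))

    swapped-injective : ∀ {n n′} (s : PrimePowerSplit ℓ n) (s′ : PrimePowerSplit ℓ n′) →
                        ¬ p ∣ n → ¬ p ∣ n′ → swapped s ≡ swapped s′ → n ≡ n′
    swapped-injective s s′ p∤n p∤n′ eq
      with prime-split-injective pp (p∤cofactor s p∤n) (p∤cofactor s′ p∤n′) (exponent s) (exponent s′) eq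
    ... | e≡e′ , u≡u′ = trans (split s) (trans (cong₂ (λ e u → ℓ ^ e * u) e≡e′ u≡u′) (sym (split s′)))

    rep⇒p∤ : ∀ {n} → Rep m y n → ¬ p ∣ n
    rep⇒p∤ (d , l , (_ , d∣m) , (_ , l-smooth) , n≡dl) p∣n with euclidsLemma d l pp (subst (p ∣_) n≡dl p∣n)
    ... | inj₁ p∣d = p∤m (∣-trans p∣d d∣m)
    ... | inj₂ p∣l = <⇒≱ y<p (l-smooth p pp p∣l)

    swapped-rep : ∀ {n} (s : PrimePowerSplit ℓ n) → Rep m y n → Rep (p ^ a * m₀) y (swapped s)
    swapped-rep {n} s (d , l , (1≤d , d∣m) , (1≤l , l-smooth) , n≡dl)
      with splitPrimePower pℓ d {{>-nonZero 1≤d}}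
    ... | mkSplit f d₀ d≡ ℓ∤d₀
      with prime-split-∣ pℓ ℓ∤d₀ ℓ∤m₀ f a (subst₂ _∣_ d≡ m≡ d∣m)
         | prime-split-injective pℓ (∤cofactor s) ℓ∤d₀l (exponent s) f (trans (sym (split s)) n≡)
      where
      ℓ∤d₀l : ¬ ℓ ∣ d₀ * l
      ℓ∤d₀l ℓ∣ with euclidsLemma d₀ l pℓ ℓ∣
      ... | inj₁ ℓ∣d₀ = ℓ∤d₀ ℓ∣d₀
      ... | inj₂ ℓ∣l  = <⇒≱ (<-≤-trans y<p p≤ℓ) (l-smooth ℓ pℓ ℓ∣l)

      n≡ : n ≡ ℓ ^ f * (d₀ * l)
      n≡ = trans n≡dl (trans (cong (_* l) d≡) (*-assoc (ℓ ^ f) d₀ l))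
    ... | f≤a , d₀∣m₀ | e≡f , u≡d₀l =
      p ^ f * d₀ , l ,
      (>-nonZero⁻¹ _ {{m*n≢0 (p ^ f) d₀ {{m^n≢0 p f}} {{∤⇒nonZero ℓ∤d₀}}}} ,
       *-pres-∣ (^-monoʳ-∣ p f≤a) d₀∣m₀) ,
      (1≤l , l-smooth) ,
      (begin
        p ^ exponent s * cofactor s ≡⟨ cong₂ (λ e u → p ^ e * u) e≡f u≡d₀l ⟩
        p ^ f * (d₀ * l)            ≡⟨ *-assoc (p ^ f) d₀ l ⟨
        p ^ f * d₀ * l              ∎)

  τ≤τ-swap : ∀ z → τ m y z ≤ τ (p ^ a * m₀) y z
  τ≤τ-swap = count-≤-injection (rep? m y) (rep? (p ^ a * m₀) y) shrink
    (λ {k} rep → subst (Rep _ y) (sym (suc-shrink k)) (swapped-rep (splitSuc k) rep))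
    (λ {k} _ → ≤-pred (subst (_≤ suc k) (sym (suc-shrink k)) (swapped-≤ (splitSuc k))))
    (λ {j} {k} rep-j rep-k eq → suc-injective (swapped-injective (splitSuc j) (splitSuc k)
      (rep⇒p∤ rep-j) (rep⇒p∤ rep-k) (trans (sym (suc-shrink j)) (trans (cong suc eq) (suc-shrink k)))))
    where
    splitSuc : ∀ k → PrimePowerSplit ℓ (suc k)
    splitSuc k = splitPrimePower pℓ (suc k)

    shrink : ℕ → ℕ
    shrink k = pred (swapped (splitSuc k))

    suc-shrink : ∀ k → suc (shrink k) ≡ swapped (splitSuc k)
    suc-shrink k = suc-pred (swapped (splitSuc k)) {{swapped-nonZero (splitSuc k)}}

τ-descent : ∀ {m y q ℓ} .{{_ : NonZero m}} → PrimeProdBound y m q → Prime ℓ → q < ℓ → ℓ ∣ m →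
           ∃ λ m′ → 0 < m′ × m′ < m × (∀ z → τ m y z ≤ τ m′ y z)
τ-descent {m} {y} {q} {ℓ} bound pℓ q<ℓ ℓ∣m =
  swap-out (∃-prime-nondivisor-below {y} ℓ∣m (≰⇒> λ prod≤m → <⇒≱ q<ℓ (bound ℓ pℓ prod≤m)))
           (splitPrimePower pℓ m)
  where
  swap-out : (∃ λ p → p < ℓ × Prime p × y < p × ¬ p ∣ m) → PrimePowerSplit ℓ m →
             ∃ λ m′ → 0 < m′ × m′ < m × (∀ z → τ m y z ≤ τ m′ y z)
  swap-out _ (mkSplit zero m₀ m≡ ℓ∤m₀) = contradiction (subst (ℓ ∣_) (trans m≡ (*-identityˡ m₀)) ℓ∣m) ℓ∤m₀
  swap-out (p , p<ℓ , pp , y<p , p∤m) (mkSplit a@(suc _) m₀ m≡ ℓ∤m₀) =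
    p ^ a * m₀ , >-nonZero⁻¹ (p ^ a * m₀) , swapped<m ,
    τ≤τ-swap {m} {y} {ℓ} {p} {a} {m₀} pℓ pp y<p (<⇒≤ p<ℓ) p∤m m≡ ℓ∤m₀
    where
    instance
      p-nonZero : NonZero p
      p-nonZero = prime⇒nonZero pp
      p^a-nonZero : NonZero (p ^ a)
      p^a-nonZero = m^n≢0 p a
      m₀-nonZero : NonZero m₀
      m₀-nonZero = ∤⇒nonZero ℓ∤m₀
      p^a*m₀-nonZero : NonZero (p ^ a * m₀)
      p^a*m₀-nonZero = m*n≢0 (p ^ a) m₀

    swapped<m : p ^ a * m₀ < m
    swapped<m = subst (p ^ a * m₀ <_) (sym m≡) (*-monoˡ-< m₀ (^-monoˡ-< a p<ℓ))

τ≤Ψ : ∀ {y q} z m .{{_ : NonZero m}} → PrimeProdBound y m q → τ m y z ≤ Ψ z q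
τ≤Ψ {y} {q} z = <-rec (λ m → .{{NonZero m}} → PrimeProdBound y m q → τ m y z ≤ Ψ z q) step
  where
  step : ∀ m → (∀ {m′} → m′ < m → .{{NonZero m′}} → PrimeProdBound y m′ q → τ m′ y z ≤ Ψ z q) →
         .{{NonZero m}} → PrimeProdBound y m q → τ m y z ≤ Ψ z q
  step m rec bound = by-cases (anyUpTo? (λ r → prime? r ×-dec q <? r ×-dec r ∣? m) (suc m))
    where
    by-reduction : (∃ λ m′ → 0 < m′ × m′ < m × (∀ z → τ m y z ≤ τ m′ y z)) → τ m y z ≤ Ψ z q
    by-reduction (m′ , 0<m′ , m′<m , τ≤τ′) =
      ≤-trans (τ≤τ′ z) (rec m′<m {{>-nonZero 0<m′}} (PrimeProdBound-anti {y} (<⇒≤ m′<m) bound))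

    by-cases : Dec (∃ λ r → r < suc m × Prime r × q < r × r ∣ m) → τ m y z ≤ Ψ z q
    by-cases (yes (ℓ , _ , pℓ , q<ℓ , ℓ∣m)) = by-reduction (τ-descent {m} {y} {q} bound pℓ q<ℓ ℓ∣m)
    by-cases (no none) = τ≤Ψ-if-prime-factors-≤ {m} {y} bound
      (λ r pr r∣m → ≮⇒≥ λ q<r → none (r , s≤s (∣⇒≤ r∣m) , pr , q<r , r∣m)) z

lemma5p4 : (m y z q : ℕ) → 2 ≤ m
    → Prime q → primeProd y q ≤ m
    → (∀ p → Prime p → primeProd y p ≤ m → p ≤ q)
    → τ m y z ≤ Ψ z q
lemma5p4 m y z q 2≤m _ _ maximal = τ≤Ψ z m {{>-nonZero (<-trans z<s 2≤m)}} maximal
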